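{- Let $S,T$ be nonempty subsets of $[n-1]$ such that $T_n\langle S;T\rangle$ is a walk-ensured Toeplitz matrix, and let $d=\gcd(S\cup T)$. Then for any positive integer $s^\ast\le n-d$, both $T_n\langle S\cup\{s^\ast\};T\rangle$ and $T_n\langle S;T\cup\{s^\ast\}\rangle$ are walk-ensured Toeplitz matrices.
   Context: Matrices are Boolean ($0,1$ entries with $1+1=1$). For nonempty $S,T\subseteq[n-1]$, $T_n\langle S;T\rangle$ denotes the $n\times n$ $(0,1)$-matrix whose $(i,j)$-entry is $1$ if and only if $j-i\in S$ or $i-j\in T$. Its digraph $D(A)$ has vertex set $[n]$ and an arc $(i,j)$ exactly when the $(i,j)$-entry is $1$. $\gcd(S\cup T)$ is the gcd of all elements of $S\cup T$. Let $s_1=\min S$ and $\gcd(S+T)=\gcd\{s+t: s\in S,t\in T\}$. The matrix $A=T_n\langle S;T\rangle$ is called walk-ensured if there is a positive integer $M$ such that for all vertices $u,v\in[n]$ and every integer $\ell\ge M$ with $v-u\equiv \ell s_1 \pmod{\gcd(S+T)}$, there is a directed walk from $u$ to $v$ of length $\ell$ in $D(A)$. -}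

module Defs where

open import Data.Nat using (ℕ; zero; suc; _+_; _*_; _∸_; _≤_; _<_; _⊓_)
open import Data.Nat.GCD using (gcd)
open import Data.List using (List; []; _∷_; foldr; concatMap; map; _++_)
open import Data.List.Membership.Propositional using (_∈_)
open import Data.List.Relation.Unary.All using (All)
open import Data.Integer as ℤ using (ℤ; +_)
open import Data.Integer.Divisibility as ℤD using ()
open import Data.Product using (Σ; ∃; _×_)
open import Data.Sum using (_⊎_)
open import Relation.Binary.PropositionalEquality using (_≡_)

-- Finite sets of naturals are represented by lists (membership = _∈_,
-- duplicates irrelevant).  S ⊆ [n-1] and nonempty:
NonemptySubsetOf[n-1] : ℕ → List ℕ → Set
NonemptySubsetOf[n-1] n S = (Σ ℕ λ x → x ∈ S) × All (λ s → 1 ≤ s × s ≤ n ∸ 1) S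

gcdL : List ℕ → ℕ
gcdL = foldr gcd 0

-- minimum of a list (only used on nonempty lists)
minL : List ℕ → ℕ
minL []       = 0
minL (x ∷ xs) = foldr _⊓_ x xs

sumset : List ℕ → List ℕ → List ℕ
sumset S T = concatMap (λ s → map (λ t → s + t) T) S

-- (i,j)-entry of T_n⟨S;T⟩ is 1 : j - i ∈ S or i - j ∈ T
Entry1 : List ℕ → List ℕ → ℕ → ℕ → Set
Entry1 S T i j = (Σ ℕ λ s → s ∈ S × i + s ≡ j) ⊎ (Σ ℕ λ t → t ∈ T × j + t ≡ i)

InRange : ℕ → ℕ → Set
InRange n i = 1 ≤ i × i ≤ n

Arc : ℕ → List ℕ → List ℕ → ℕ → ℕ → Set
Arc n S T i j = InRange n i × InRange n j × Entry1 S T i j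

data Walk (n : ℕ) (S T : List ℕ) : ℕ → ℕ → ℕ → Set where
  here : ∀ {u} → InRange n u → Walk n S T u u 0
  step : ∀ {u w v ℓ} → Arc n S T u w → Walk n S T w v ℓ → Walk n S T u v (suc ℓ)

WalkEnsured : ℕ → List ℕ → List ℕ → Set
WalkEnsured n S T =
  Σ ℕ λ M → 1 ≤ M ×
    (∀ u v ℓ → InRange n u → InRange n v → M ≤ ℓ →
      (+ gcdL (sumset S T)) ℤD.∣ ((+ v ℤ.- + u) ℤ.- + (ℓ * minL S)) →
      Walk n S T u v ℓ)

{-# OPTIONS --safe #-}

-- Let G = gcd(S+T), c = s₁ and d = gcd(S∪T).  Modulo G every element of S is ≡ c and every
-- element of T is ≡ −c, and gcd(G, c) divides d.  The new difference s* gives arcs a → a + e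
-- (e = s* for S, e = −s* for T), and since s* + d ≤ n every residue class mod d contains such
-- a launch vertex a.  A walk of length ℓ from u to v may now take k new arcs: walk in the old
-- digraph to a launch vertex (Bézout, as a − u ≡ 0 mod gcd(G, c), gives a suitable length
-- below M + G), take the arc, repeat.  Each new arc shifts v − u − ℓc by e − c modulo G, so
-- with k < G every defect divisible by h = gcd(G, e − c) is absorbed.  Finally S′ ≡ c and
-- T′ ≡ −c modulo h, so h divides gcd(S′+T′) and min S′ − c, and the walk-ensured condition
-- for the new matrix implies the one solved this way.

module Submission where

open import Defs
open import Data.Nat as ℕ using (ℕ; zero; suc; _≤_; _<_; _∸_; NonZero)
open import Data.Nat.Properties as ℕ using ()
open import Data.Nat.GCD using (gcd; gcd-GCD; gcd[m,n]∣m; gcd[m,n]∣n; gcd-greatest; module Bézout)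
open import Function using (_∘_)
open import Data.Integer as ℤ using (ℤ; +_; -[1+_]; _+_; _*_; _-_; -_)
open import Data.Integer.Properties as ℤ using (pos-*)
open import Data.Integer.DivMod using (_%ℕ_; _/ℕ_; n%ℕd<d; a≡a%ℕn+[a/ℕn]*n)
open import Data.Integer.Tactic.RingSolver using (solve-∀)
open import Data.Nat.Divisibility as ℕ∣ using ()
import Data.Integer.Divisibility as ℤ∣ᵤ
open import Data.Integer.Divisibility.Signed as ℤ∣ using (_∣_; divides; ∣m∣n⇒∣m+n; ∣m∣n⇒∣m-n; ∣m⇒∣-m; ∣n⇒∣m*n; ∣m⇒∣m*n; ∣ᵤ⇒∣; ∣⇒∣ᵤ)
open import Data.List using (List; []; _∷_; _++_; map; cartesianProductWith)
open import Data.List.Membership.Propositional using (_∈_)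
open import Data.List.Membership.Propositional.Properties using (∈-++⁻; ∈-++⁺ˡ; ∈-cartesianProductWith⁺; ∈-cartesianProductWith⁻; foldr-selective)
open import Data.List.Relation.Unary.Any using (here; there)
open import Data.List.Relation.Unary.All as All using (All; []; _∷_)
open import Data.List.Relation.Binary.Subset.Propositional using (_⊆_)
open import Data.Product using (∃-syntax; ∃₂; _×_; _,_; proj₁; proj₂)
open import Data.Sum using (inj₁; inj₂)
open import Relation.Nullary using (contradiction)
open import Relation.Binary.PropositionalEquality using (_≡_; refl; sym; trans; cong; subst; module ≡-Reasoning)

∣-nonZero : ∀ {m n} → 0 < n → m ℕ∣.∣ n → NonZero m
∣-nonZero {zero}  0<n 0∣n = contradiction (sym (ℕ∣.0∣⇒≡0 0∣n)) (ℕ.<⇒≢ 0<n)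
∣-nonZero {suc _} _   _   = _

0<m≤o∸n⇒m+n≤o : ∀ {m n o} → 0 < m → m ≤ o ∸ n → m ℕ.+ n ≤ o
0<m≤o∸n⇒m+n≤o {m} 0<m m≤o∸n =
  ℕ.m≤o∸n⇒m+n≤o m (ℕ.<⇒≤ (ℕ.m∸n≢0⇒n<m λ o∸n≡0 → ℕ.<⇒≢ (ℕ.<-≤-trans 0<m m≤o∸n) (sym o∸n≡0))) m≤o∸n

length-split : ∀ {a b x ℓ} → a < b → b ℕ.+ x ≤ ℓ → ∃[ ℓ′ ] x ≤ ℓ′ × ℓ ≡ a ℕ.+ suc ℓ′
length-split {a} {b} {x} a<b b+x≤ℓ with ℕ.m≤n⇒∃[o]m+o≡n (ℕ.≤-trans (ℕ.+-monoˡ-≤ x a<b) b+x≤ℓ)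
... | o , refl = x ℕ.+ o , ℕ.m≤m+n x o , sym (trans (ℕ.+-suc a (x ℕ.+ o)) (sym (ℕ.+-assoc (suc a) x o)))

window-representative : ∀ (z : ℤ) (B d : ℕ) .{{_ : NonZero d}} →
                        ∃[ r ] B ≤ r × r < B ℕ.+ d × + d ∣ z - + r
window-representative z B d =
  B ℕ.+ r , ℕ.m≤m+n B r , ℕ.+-monoʳ-< B (n%ℕd<d (z - + B) d) , divides q (begin
    z - + (B ℕ.+ r)        ≡⟨ regroup z (+ B) (+ r) ⟩
    (z - + B) - + r        ≡⟨ cong (_- + r) (a≡a%ℕn+[a/ℕn]*n (z - + B) d) ⟩
    (+ r + q * + d) - + r  ≡⟨ cancel (+ r) (q * + d) ⟩
    q * + d                ∎)
  where
  open ≡-Reasoning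
  r : ℕ
  r = (z - + B) %ℕ d
  q : ℤ
  q = (z - + B) /ℕ d
  regroup : ∀ z b r → z - (b + r) ≡ (z - b) - r
  regroup = solve-∀
  cancel : ∀ r x → (r + x) - r ≡ x
  cancel = solve-∀

bezout-ℕ : ∀ G a → ∃[ z ] + G ∣ + gcd G a - z * + a
bezout-ℕ G a with Bézout.identity (gcd-GCD G a)
... | Bézout.+- x y eq = - + y , divides (+ x) (begin
  + gcd G a - - + y * + a     ≡⟨ double-negation (+ gcd G a) (+ y) (+ a) ⟩
  + gcd G a + + y * + a       ≡⟨ cong (λ w → + gcd G a + w) (pos-* y a) ⟨
  + (gcd G a ℕ.+ y ℕ.* a)     ≡⟨ cong +_ eq ⟩
  + (x ℕ.* G)                 ≡⟨ pos-* x G ⟩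
  + x * + G                   ∎)
  where
  open ≡-Reasoning
  double-negation : ∀ h y a → h - - y * a ≡ h + y * a
  double-negation = solve-∀
... | Bézout.-+ x y eq = + y , divides (- + x) (begin
  + gcd G a - + y * + a                     ≡⟨ cong (λ w → + gcd G a - w) (pos-* y a) ⟨
  + gcd G a - + (y ℕ.* a)                   ≡⟨ cong (λ w → + gcd G a - + w) eq ⟨
  + gcd G a - + (gcd G a ℕ.+ x ℕ.* G)       ≡⟨ cong (λ w → + gcd G a - (+ gcd G a + w)) (pos-* x G) ⟩
  + gcd G a - (+ gcd G a + + x * + G)       ≡⟨ cancel (+ gcd G a) (+ x) (+ G) ⟩
  - + x * + G                               ∎)
  where
  open ≡-Reasoning
  cancel : ∀ h x g → h - (h + x * g) ≡ - x * g
  cancel = solve-∀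

bezout : ∀ G y → ∃[ z ] + G ∣ + gcd G (ℤ.∣ y ∣) - z * y
bezout G (+ a) = bezout-ℕ G a
bezout G -[1+ m ] with bezout-ℕ G (suc m)
... | z , G∣ = - z , subst (λ w → + G ∣ + gcd G (suc m) - w) (negate-both z (+ suc m)) G∣
  where
  negate-both : ∀ z a → z * a ≡ - z * - a
  negate-both = solve-∀

congruence-solvable-in-window : ∀ G .{{_ : NonZero G}} (y X : ℤ) (B : ℕ) →
  + gcd G (ℤ.∣ y ∣) ∣ X → ∃[ k ] B ≤ k × k < B ℕ.+ G × + G ∣ X - + k * y
congruence-solvable-in-window G y X B (divides q refl) with bezout G y
... | z , G∣h-zy with window-representative (q * z) B G
... | k , B≤k , k<B+G , G∣qz-k = k , B≤k , k<B+G ,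
  subst (+ G ∣_) (regroup q (+ gcd G (ℤ.∣ y ∣)) z (+ k) y)
    (∣m∣n⇒∣m+n (∣n⇒∣m*n q G∣h-zy) (∣m⇒∣m*n y G∣qz-k))
  where
  regroup : ∀ q h z k y → q * (h - z * y) + (q * z - k) * y ≡ q * h - k * y
  regroup = solve-∀

vertex-pair-in-class : ∀ {n d s} .{{_ : NonZero d}} → s ℕ.+ d ≤ n → ∀ z →
  ∃[ m ] InRange n m × InRange n (m ℕ.+ s) × + d ∣ z - + m
vertex-pair-in-class {n} {d} {s} s+d≤n z with window-representative z 1 d
... | m , 1≤m , m<1+d , d∣z-m =
  m , (1≤m , ℕ.≤-trans (ℕ.m≤m+n m s) m+s≤n) , (ℕ.≤-trans 1≤m (ℕ.m≤m+n m s) , m+s≤n) , d∣z-m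
  where
  m+s≤n : m ℕ.+ s ≤ n
  m+s≤n = ℕ.≤-trans (ℕ.+-monoˡ-≤ s (ℕ.m<1+n⇒m≤n m<1+d)) (subst (_≤ n) (ℕ.+-comm s d) s+d≤n)

sumset≡cartesianProductWith : ∀ S T → sumset S T ≡ cartesianProductWith ℕ._+_ S T
sumset≡cartesianProductWith []      T = refl
sumset≡cartesianProductWith (s ∷ S) T = cong (map (s ℕ.+_) T ++_) (sumset≡cartesianProductWith S T)

∈-sumset⁺ : ∀ {S T s t} → s ∈ S → t ∈ T → s ℕ.+ t ∈ sumset S T
∈-sumset⁺ {S} {T} s∈S t∈T =
  subst (_ ∈_) (sym (sumset≡cartesianProductWith S T)) (∈-cartesianProductWith⁺ ℕ._+_ s∈S t∈T)

∈-sumset⁻ : ∀ S T {x} → x ∈ sumset S T → ∃₂ λ s t → s ∈ S × t ∈ T × x ≡ s ℕ.+ t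
∈-sumset⁻ S T x∈S+T =
  ∈-cartesianProductWith⁻ ℕ._+_ S T (subst (_ ∈_) (sumset≡cartesianProductWith S T) x∈S+T)

gcdL-∣ : ∀ {x xs} → x ∈ xs → gcdL xs ℕ∣.∣ x
gcdL-∣ {xs = y ∷ ys} (here refl) = gcd[m,n]∣m y (gcdL ys)
gcdL-∣ {xs = y ∷ ys} (there x∈ys) = ℕ∣.∣-trans (gcd[m,n]∣n y (gcdL ys)) (gcdL-∣ x∈ys)

gcdL-greatest : ∀ {h} xs → (∀ {x} → x ∈ xs → h ℕ∣.∣ x) → h ℕ∣.∣ gcdL xs
gcdL-greatest {h} []   _    = h ℕ∣.∣0
gcdL-greatest (x ∷ xs) h∣xs = gcd-greatest (h∣xs (here refl)) (gcdL-greatest xs (h∣xs ∘ there))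

minL-∈ : ∀ {x S} → x ∈ S → minL S ∈ S
minL-∈ {S = y ∷ ys} _ with foldr-selective ℕ.⊓-sel y ys
... | inj₁ min≡y   = here min≡y
... | inj₂ min∈ys  = there min∈ys

sumset-gcd-from-classes : ∀ {h c} S T → All (λ s → + h ∣ + s - + c) S → All (λ t → + h ∣ + t + + c) T →
  h ℕ∣.∣ gcdL (sumset S T)
sumset-gcd-from-classes {h} {c} S T S≡c T≡-c = gcdL-greatest (sumset S T) h∣sum
  where
  recombine : ∀ s t c → (s - c) + (t + c) ≡ s + t
  recombine = solve-∀
  h∣sum : ∀ {x} → x ∈ sumset S T → h ℕ∣.∣ x
  h∣sum x∈S+T with ∈-sumset⁻ S T x∈S+T
  ... | s , t , s∈S , t∈T , refl = ∣⇒∣ᵤ (subst (+ h ∣_) (recombine (+ s) (+ t) (+ c))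
          (∣m∣n⇒∣m+n (All.lookup S≡c s∈S) (All.lookup T≡-c t∈T)))

classes-from-sumset-gcd : ∀ {h c t₀ S T} → c ∈ S → t₀ ∈ T → h ℕ∣.∣ gcdL (sumset S T) →
  All (λ s → + h ∣ + s - + c) S × All (λ t → + h ∣ + t + + c) T
classes-from-sumset-gcd {h} {c} {t₀} {S} {T} c∈S t₀∈T h∣G = All.tabulate S≡c , All.tabulate T≡-c
  where
  h∣sum : ∀ {s t} → s ∈ S → t ∈ T → + h ∣ + s + + t
  h∣sum s∈S t∈T = ∣ᵤ⇒∣ (ℕ∣.∣-trans h∣G (gcdL-∣ (∈-sumset⁺ s∈S t∈T)))
  cancel : ∀ s c t → (s + t) - (c + t) ≡ s - c
  cancel = solve-∀
  S≡c : ∀ {s} → s ∈ S → + h ∣ + s - + c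
  S≡c {s} s∈S = subst (+ h ∣_) (cancel (+ s) (+ c) (+ t₀)) (∣m∣n⇒∣m-n (h∣sum s∈S t₀∈T) (h∣sum c∈S t₀∈T))
  T≡-c : ∀ {t} → t ∈ T → + h ∣ + t + + c
  T≡-c {t} t∈T = subst (+ h ∣_) (ℤ.+-comm (+ c) (+ t)) (h∣sum c∈S t∈T)

gcd[gcd[S+T],c]∣gcd[S++T] : ∀ {c t₀ S T} → c ∈ S → t₀ ∈ T → gcd (gcdL (sumset S T)) c ℕ∣.∣ gcdL (S ++ T)
gcd[gcd[S+T],c]∣gcd[S++T] {c} {t₀} {S} {T} c∈S t₀∈T = gcdL-greatest (S ++ T) h∣
  where
  h : ℕ
  h = gcd (gcdL (sumset S T)) c
  h∣c : + h ∣ + c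
  h∣c = ∣ᵤ⇒∣ (gcd[m,n]∣n (gcdL (sumset S T)) c)
  classes : All (λ s → + h ∣ + s - + c) S × All (λ t → + h ∣ + t + + c) T
  classes = classes-from-sumset-gcd c∈S t₀∈T (gcd[m,n]∣m (gcdL (sumset S T)) c)
  add-back : ∀ x c → (x - c) + c ≡ x
  add-back = solve-∀
  take-back : ∀ x c → (x + c) - c ≡ x
  take-back = solve-∀
  h∣ : ∀ {x} → x ∈ S ++ T → h ℕ∣.∣ x
  h∣ {x} x∈S++T with ∈-++⁻ S x∈S++T
  ... | inj₁ x∈S = ∣⇒∣ᵤ (subst (+ h ∣_) (add-back (+ x) (+ c))
          (∣m∣n⇒∣m+n (All.lookup (proj₁ classes) x∈S) h∣c))
  ... | inj₂ x∈T = ∣⇒∣ᵤ (subst (+ h ∣_) (take-back (+ x) (+ c))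
          (∣m∣n⇒∣m-n (All.lookup (proj₂ classes) x∈T) h∣c))

Entry1-mono : ∀ {S T S′ T′ i j} → S ⊆ S′ → T ⊆ T′ → Entry1 S T i j → Entry1 S′ T′ i j
Entry1-mono S⊆S′ _ (inj₁ (s , s∈S , eq)) = inj₁ (s , S⊆S′ s∈S , eq)
Entry1-mono _ T⊆T′ (inj₂ (t , t∈T , eq)) = inj₂ (t , T⊆T′ t∈T , eq)

Walk-mono : ∀ {n S T S′ T′ u v ℓ} → S ⊆ S′ → T ⊆ T′ → Walk n S T u v ℓ → Walk n S′ T′ u v ℓ
Walk-mono _     _     (here u∈[n])                = here u∈[n]
Walk-mono S⊆S′ T⊆T′ (step (u∈[n] , w∈[n] , e) w) =
  step (u∈[n] , w∈[n] , Entry1-mono S⊆S′ T⊆T′ e) (Walk-mono S⊆S′ T⊆T′ w)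

_++ʷ_ : ∀ {n S T u w v ℓ₁ ℓ₂} → Walk n S T u w ℓ₁ → Walk n S T w v ℓ₂ → Walk n S T u v (ℓ₁ ℕ.+ ℓ₂)
here _     ++ʷ w₂ = w₂
step a w₁ ++ʷ w₂ = step a (w₁ ++ʷ w₂)

WalkEnsuredBy : ℕ → List ℕ → List ℕ → (G c M : ℕ) → Set
WalkEnsuredBy n S T G c M = ∀ u v ℓ → InRange n u → InRange n v → M ≤ ℓ →
  + G ∣ + v - + u - + ℓ * + c → Walk n S T u v ℓ

WalkEnsured⇒WalkEnsuredBy : ∀ {n S T} (we : WalkEnsured n S T) →
  WalkEnsuredBy n S T (gcdL (sumset S T)) (minL S) (proj₁ we)
WalkEnsured⇒WalkEnsuredBy {S = S} (_ , _ , we) u v ℓ u∈[n] v∈[n] M≤ℓ G∣ =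
  we u v ℓ u∈[n] v∈[n] M≤ℓ (∣⇒∣ᵤ (subst (λ w → _ ∣ + v - + u - w) (sym (pos-* ℓ (minL S))) G∣))

walkEnsured-from-classes : ∀ {n S T h c M x} → 0 < M → x ∈ S →
  All (λ s → + h ∣ + s - + c) S → All (λ t → + h ∣ + t + + c) T →
  WalkEnsuredBy n S T h c M → WalkEnsured n S T
walkEnsured-from-classes {n} {S} {T} {h} {c} {M} 0<M x∈S S≡c T≡-c ensured =
  M , 0<M , λ u v ℓ u∈[n] v∈[n] M≤ℓ G∣ → ensured u v ℓ u∈[n] v∈[n] M≤ℓ (h∣ {u} {v} {ℓ} G∣)
  where
  regroup : ∀ x l c′ c → (x - l * c′) + l * (c′ - c) ≡ x - l * c
  regroup = solve-∀
  h∣ : ∀ {u v ℓ} → (+ gcdL (sumset S T)) ℤ∣ᵤ.∣ + v - + u - + (ℓ ℕ.* minL S) → + h ∣ + v - + u - + ℓ * + c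
  h∣ {u} {v} {ℓ} G∣ = subst (+ h ∣_) (regroup (+ v - + u) (+ ℓ) (+ minL S) (+ c))
    (∣m∣n⇒∣m+n
      (ℤ∣.∣-trans (∣ᵤ⇒∣ {+ h} {+ gcdL (sumset S T)} (sumset-gcd-from-classes S T S≡c T≡-c))
        (subst (λ w → _ ∣ + v - + u - w) (pos-* ℓ (minL S)) (∣ᵤ⇒∣ G∣)))
      (∣n⇒∣m*n (+ ℓ) (All.lookup S≡c (minL-∈ x∈S))))

module Extension
  {n : ℕ} {S T S′ T′ : List ℕ} (S⊆S′ : S ⊆ S′) (T⊆T′ : T ⊆ T′)
  {G c M : ℕ} .{{_ : NonZero G}} (ensured : WalkEnsuredBy n S T G c M)
  (e : ℤ)
  (launch : ∀ p → InRange n p →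
            ∃₂ λ a b → Arc n S′ T′ a b × + b ≡ + a + e × + gcd G c ∣ + a - + p)
  where

  reach : ∀ {p a} → InRange n p → InRange n a → + gcd G c ∣ + a - + p →
          ∃[ L ] L < M ℕ.+ G × Walk n S T p a L × + G ∣ + a - + p - + L * + c
  reach {p} {a} p∈[n] a∈[n] h∣a-p with congruence-solvable-in-window G (+ c) (+ a - + p) M h∣a-p
  ... | L , M≤L , L<M+G , G∣ = L , L<M+G , ensured p a L p∈[n] a∈[n] M≤L G∣ , G∣

  -- k counts the new arcs still to be taken; each is reached by an old walk of length L with
  -- a − u ≡ L c (mod G), so the arc itself contributes e − c to the defect.
  walk-through-launches : ∀ k {u v ℓ} → InRange n u → InRange n v → k ℕ.* (M ℕ.+ G) ℕ.+ M ≤ ℓ →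
    + G ∣ + v - + u - + ℓ * + c - + k * (e - + c) → Walk n S′ T′ u v ℓ
  walk-through-launches zero {u} {v} {ℓ} u∈[n] v∈[n] M≤ℓ G∣ =
    Walk-mono S⊆S′ T⊆T′ (ensured u v ℓ u∈[n] v∈[n] M≤ℓ (subst (+ G ∣_) (no-launch _ (e - + c)) G∣))
    where
    no-launch : ∀ x y → x - + 0 * y ≡ x
    no-launch = solve-∀
  walk-through-launches (suc k) {u} {v} {ℓ} u∈[n] v∈[n] bound G∣ with launch u u∈[n]
  ... | a , b , arc@(a∈[n] , b∈[n] , _) , b≡a+e , h∣a-u with reach u∈[n] a∈[n] h∣a-u
  ... | L , L<M+G , u⇝a , G∣a-u
    with length-split L<M+G (subst (_≤ ℓ) (ℕ.+-assoc (M ℕ.+ G) (k ℕ.* (M ℕ.+ G)) M) bound)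
  ... | ℓ′ , bound′ , refl =
    Walk-mono S⊆S′ T⊆T′ u⇝a ++ʷ step arc (walk-through-launches k b∈[n] v∈[n] bound′ G∣′)
    where
    -- Stated with 1 + ℓ′ and 1 + k so that at + L, + ℓ′, + k it matches + (L + suc ℓ′) and
    -- + suc k definitionally.
    regroup : ∀ v u a e c L ℓ′ k →
      v - (a + e) - ℓ′ * c - k * (e - c) ≡
      (v - u - (L + (+ 1 + ℓ′)) * c - (+ 1 + k) * (e - c)) - (a - u - L * c)
    regroup = solve-∀
    G∣′ : + G ∣ + v - + b - + ℓ′ * + c - + k * (e - + c)
    G∣′ = subst (λ x → + G ∣ + v - x - + ℓ′ * + c - + k * (e - + c)) (sym b≡a+e)
            (subst (+ G ∣_) (sym (regroup (+ v) (+ u) (+ a) e (+ c) (+ L) (+ ℓ′) (+ k)))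
              (∣m∣n⇒∣m-n G∣ G∣a-u))

  extended : WalkEnsuredBy n S′ T′ (gcd G (ℤ.∣ e - + c ∣)) c (G ℕ.* (M ℕ.+ G) ℕ.+ M)
  extended u v ℓ u∈[n] v∈[n] bound h∣
    with congruence-solvable-in-window G (e - + c) (+ v - + u - + ℓ * + c) 0 h∣
  ... | k , _ , k<G , G∣ = walk-through-launches k u∈[n] v∈[n]
          (ℕ.≤-trans (ℕ.+-monoˡ-≤ M (ℕ.*-monoˡ-≤ (M ℕ.+ G) (ℕ.<⇒≤ k<G))) bound) G∣

module NewDifference
  {n M : ℕ} {S T : List ℕ} {t₀ : ℕ} (t₀∈T : t₀ ∈ T) (c∈S : minL S ∈ S) (0<c : 0 < minL S)
  (0<M : 0 < M) (ensured : WalkEnsuredBy n S T (gcdL (sumset S T)) (minL S) M)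
  {s* : ℕ} (s*+d≤n : s* ℕ.+ gcdL (S ++ T) ≤ n)
  where

  private
    c G d : ℕ
    c = minL S
    G = gcdL (sumset S T)
    d = gcdL (S ++ T)

    instance
      G-nonZero : NonZero G
      G-nonZero = ∣-nonZero (ℕ.<-≤-trans 0<c (ℕ.m≤m+n c t₀)) (gcdL-∣ (∈-sumset⁺ c∈S t₀∈T))

      d-nonZero : NonZero d
      d-nonZero = ∣-nonZero 0<c (gcdL-∣ (∈-++⁺ˡ c∈S))

    classes : ∀ {h} → h ℕ∣.∣ G → All (λ s → + h ∣ + s - + c) S × All (λ t → + h ∣ + t + + c) T
    classes = classes-from-sumset-gcd c∈S t₀∈T

    gcd[G,c]∣d : + gcd G c ∣ + d
    gcd[G,c]∣d = ∣ᵤ⇒∣ (gcd[gcd[S+T],c]∣gcd[S++T] c∈S t₀∈T)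

    negate : ∀ x y → - (x - y) ≡ y - x
    negate = solve-∀

    launch-S : ∀ p → InRange n p → ∃₂ λ a b →
      Arc n (s* ∷ S) T a b × + b ≡ + a + + s* × + gcd G c ∣ + a - + p
    launch-S p _ with vertex-pair-in-class {d = d} s*+d≤n (+ p)
    ... | m , m∈[n] , m+s*∈[n] , d∣p-m =
      m , m ℕ.+ s* , (m∈[n] , m+s*∈[n] , inj₁ (s* , here refl , refl)) , refl ,
      ℤ∣.∣-trans gcd[G,c]∣d (subst (+ d ∣_) (negate (+ p) (+ m)) (∣m⇒∣-m d∣p-m))

    launch-T : ∀ p → InRange n p → ∃₂ λ a b →
      Arc n S (s* ∷ T) a b × + b ≡ + a + - + s* × + gcd G c ∣ + a - + p
    launch-T p _ with vertex-pair-in-class {d = d} s*+d≤n (+ p - + s*)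
    ... | m , m∈[n] , m+s*∈[n] , d∣p-s*-m =
      m ℕ.+ s* , m , (m+s*∈[n] , m∈[n] , inj₂ (s* , here refl , refl)) , step-down (+ m) (+ s*) ,
      ℤ∣.∣-trans gcd[G,c]∣d (subst (+ d ∣_) (negate-shifted (+ p) (+ s*) (+ m)) (∣m⇒∣-m d∣p-s*-m))
      where
      step-down : ∀ m s → m ≡ (m + s) + - s
      step-down = solve-∀
      negate-shifted : ∀ p s m → - (p - s - m) ≡ (m + s) - p
      negate-shifted = solve-∀

    0<threshold : 0 < G ℕ.* (M ℕ.+ G) ℕ.+ M
    0<threshold = ℕ.<-≤-trans 0<M (ℕ.m≤n+m M _)

  walkEnsured-∷S : WalkEnsured n (s* ∷ S) T
  walkEnsured-∷S =
    walkEnsured-from-classes 0<threshold (here refl) (h∣s*-c ∷ proj₁ classes-h) (proj₂ classes-h)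
      (Extension.extended there (λ t∈T → t∈T) ensured (+ s*) launch-S)
    where
    h : ℕ
    h = gcd G (ℤ.∣ + s* - + c ∣)
    classes-h : All (λ s → + h ∣ + s - + c) S × All (λ t → + h ∣ + t + + c) T
    classes-h = classes (gcd[m,n]∣m G (ℤ.∣ + s* - + c ∣))
    h∣s*-c : + h ∣ + s* - + c
    h∣s*-c = ∣ᵤ⇒∣ (gcd[m,n]∣n G (ℤ.∣ + s* - + c ∣))

  walkEnsured-∷T : WalkEnsured n S (s* ∷ T)
  walkEnsured-∷T =
    walkEnsured-from-classes 0<threshold c∈S (proj₁ classes-h) (h∣s*+c ∷ proj₂ classes-h)
      (Extension.extended (λ s∈S → s∈S) there ensured (- + s*) launch-T)
    where
    h : ℕ
    h = gcd G (ℤ.∣ - + s* - + c ∣)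
    classes-h : All (λ s → + h ∣ + s - + c) S × All (λ t → + h ∣ + t + + c) T
    classes-h = classes (gcd[m,n]∣m G (ℤ.∣ - + s* - + c ∣))
    flip-sign : ∀ s c → - (- s - c) ≡ s + c
    flip-sign = solve-∀
    h∣s*+c : + h ∣ + s* + + c
    h∣s*+c = subst (+ h ∣_) (flip-sign (+ s*) (+ c)) (∣m⇒∣-m (∣ᵤ⇒∣ (gcd[m,n]∣n G (ℤ.∣ - + s* - + c ∣))))

theorem5p4 : (n : ℕ) (S T : List ℕ) →
    NonemptySubsetOf[n-1] n S → NonemptySubsetOf[n-1] n T →
    WalkEnsured n S T →
    (s* : ℕ) → 1 ≤ s* → s* ≤ n ∸ gcdL (S ++ T) →
    WalkEnsured n (s* ∷ S) T × WalkEnsured n S (s* ∷ T)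
theorem5p4 n S T ((_ , s₀∈S) , S⊆[n-1]) ((_ , t₀∈T) , _) we@(_ , 0<M , _) s* 0<s* s*≤n∸d =
  walkEnsured-∷S , walkEnsured-∷T
  where
  c∈S : minL S ∈ S
  c∈S = minL-∈ s₀∈S
  open NewDifference t₀∈T c∈S (proj₁ (All.lookup S⊆[n-1] c∈S)) 0<M
         (WalkEnsured⇒WalkEnsuredBy we) (0<m≤o∸n⇒m+n≤o 0<s* s*≤n∸d)
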